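{- Let $d\ge 3$ and $h\ge 2$ be integers, and let $T'(d,h)$ be the rooted tree of depth $h$ in which the root has degree $d-1$, every other non-leaf vertex has degree $d$, and all leaves are at depth $h$. Then \[ \nu_2(T'(d,h))=\begin{cases}\displaystyle 2\,\frac{(d-1)^{h+1}-(d-1)}{(d-1)^2-1} & \text{if } h \text{ is even},\\[2ex] \displaystyle 2\,\frac{(d-1)^{h+1}-1}{(d-1)^2-1} & \text{if } h \text{ is odd}.\end{cases} \]
   Context: A $2$-matching of a graph is a set of edges such that every vertex is incident to at most two of them; $\nu_2(G)$ is the maximum size of a $2$-matching of $G$. -}

module Defs where

open import Data.Nat using (ℕ; zero; suc; _+_; _*_; _∸_; _^_; _≤_)
open import Data.Nat.Properties using (≤-irrelevant)
open import Data.Fin using (Fin)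
import Data.Fin.Properties as FinP
open import Data.List using (List; []; _∷_; length; filter)
import Data.List.Properties as ListP
open import Data.List.Relation.Unary.All using (All)
open import Data.List.Relation.Unary.AllPairs using (AllPairs)
open import Data.Product using (Σ; ∃; ∃-syntax; _×_; _,_; proj₁; proj₂)
open import Data.Sum using (_⊎_)
open import Relation.Nullary using (¬_; yes; no)
open import Relation.Nullary.Decidable using (_⊎-dec_)
open import Relation.Binary.Definitions using (DecidableEquality)
open import Relation.Binary.PropositionalEquality using (_≡_; refl; cong)

record Graph : Set₁ where
  field
    V    : Set
    _≟V_ : DecidableEquality V
    Adj  : V → V → Set

module _ (G : Graph) where
  open Graph G

  Edge : Set
  Edge = V × V

  SameEdge : Edge → Edge → Set
  SameEdge (u , v) (u' , v') = (u ≡ u' × v ≡ v') ⊎ (u ≡ v' × v ≡ u')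

  incidence : V → List Edge → ℕ
  incidence x M = length (filter (λ e → (proj₁ e ≟V x) ⊎-dec (proj₂ e ≟V x)) M)

  IsTwoMatching : List Edge → Set
  IsTwoMatching M =
    All (λ e → Adj (proj₁ e) (proj₂ e)) M ×
    AllPairs (λ e f → ¬ SameEdge e f) M ×
    (∀ x → incidence x M ≤ 2)

  Nu2≡ : ℕ → Set
  Nu2≡ k =
    (∃[ M ] (IsTwoMatching M × length M ≡ k)) ×
    (∀ M → IsTwoMatching M → length M ≤ k)

-- T'(d,h): vertices are words over Fin (d ∸ 1) of length ≤ h (the root is
-- the empty word); the children of s are i ∷ s.  Hence the root has d-1
-- children (degree d-1), every other internal vertex has one parent and
-- d-1 children (degree d), and all leaves are the words of length h.
TVertex : ℕ → ℕ → Set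
TVertex d h = Σ (List (Fin (d ∸ 1))) (λ s → length s ≤ h)

TAdj : ∀ d h → TVertex d h → TVertex d h → Set
TAdj d h (s , _) (t , _) = (∃[ i ] t ≡ i ∷ s) ⊎ (∃[ i ] s ≡ i ∷ t)

_≟T_ : ∀ {d h} → DecidableEquality (TVertex d h)
(s , p) ≟T (t , q) with ListP.≡-dec FinP._≟_ s t
... | yes refl = yes (cong (s ,_) (≤-irrelevant p q))
... | no s≢t = no λ { refl → s≢t refl }

T' : ℕ → ℕ → Graph
T' d h = record { V = TVertex d h ; _≟V_ = _≟T_ {d} {h} ; Adj = TAdj d h }

-- Write q = d − 1 and let C be the set of vertices at depths h − 1, h − 3, h − 5, … .
-- Every edge joins two consecutive depths, so it has exactly one endpoint in C: C is a
-- vertex cover, and a 2-matching has at most 2|C| edges since each is counted at its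
-- endpoint in C.  Conversely every vertex of C has at least two children, and C contains
-- no vertex together with its parent, so joining each vertex of C to two of its children
-- is a 2-matching with 2|C| edges.  Hence ν₂ = 2|C| = 2(q^(h−1) + q^(h−3) + ⋯), and the
-- geometric series with ratio q² gives the closed form.

module Submission where

open import Defs
open import Data.Nat using (ℕ; zero; suc; _+_; _*_; _∸_; _^_; _≤_; _<_; _%_; z≤n; s≤s; s≤s⁻¹)
open import Data.Nat.Properties
open import Data.Nat.DivMod using ([m+n]%n≡m%n)
open import Data.Nat.ListAction using (sum)
open import Data.Nat.Tactic.RingSolver using (solve-∀)
open import Algebra.Properties.CommutativeSemigroup +-commutativeSemigroup
  using () renaming (interchange to +-interchange)
open import Data.Fin using (Fin)
import Data.Fin as Fin
import Data.Fin.Properties as FinP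
open import Data.List using (List; []; _∷_; [_]; length; filter; map; _++_; concatMap; allFin)
import Data.List.Properties as ListP
open import Data.List.Relation.Unary.All as All using (All; []; _∷_)
open import Data.List.Relation.Unary.AllPairs using (AllPairs; []; _∷_)
open import Data.List.Relation.Unary.Any using (here; there)
open import Data.List.Membership.Propositional using (_∈_; _∉_)
open import Data.List.Membership.Propositional.Properties using (∈-map⁺; ∈-allFin)
open import Data.Product using (∃-syntax; _×_; _,_; proj₁; proj₂)
open import Data.Sum using (_⊎_; inj₁; inj₂)
import Data.Sum as Sum
open import Function using (_∘_)
open import Function.Definitions using (Injective)
open import Relation.Unary using (Pred; Decidable)
open import Relation.Nullary using (¬_; Dec; yes; no; contradiction)
open import Relation.Nullary.Decidable using (_⊎-dec_)
open import Relation.Binary.Definitions using (DecidableEquality)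
open import Relation.Binary.PropositionalEquality
  using (_≡_; _≢_; refl; sym; trans; cong; cong₂; subst; module ≡-Reasoning)

indicator : ∀ {p} {P : Set p} → Dec P → ℕ
indicator (yes _) = 1
indicator (no _) = 0

module _ {p} {P : Set p} where

  indicator-yes : (P? : Dec P) → P → indicator P? ≡ 1
  indicator-yes (yes _) _ = refl
  indicator-yes (no ¬p) p = contradiction p ¬p

  indicator-no : (P? : Dec P) → ¬ P → indicator P? ≡ 0
  indicator-no (yes p) ¬p = contradiction p ¬p
  indicator-no (no _) _ = refl

  1≤indicator : (P? : Dec P) → P → 1 ≤ indicator P?
  1≤indicator P? p = ≤-reflexive (sym (indicator-yes P? p))

  indicator≤ : ∀ {n} (P? : Dec P) → (P → 1 ≤ n) → indicator P? ≤ n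
  indicator≤ (yes p) 1≤n = 1≤n p
  indicator≤ (no _) _ = z≤n

indicator-cong : ∀ {p q} {P : Set p} {Q : Set q} (P? : Dec P) (Q? : Dec Q) →
                 (P → Q) → (Q → P) → indicator P? ≡ indicator Q?
indicator-cong (yes _) (yes _) _ _ = refl
indicator-cong (yes p) (no ¬q) f _ = contradiction (f p) ¬q
indicator-cong (no ¬p) (yes q) _ g = contradiction (g q) ¬p
indicator-cong (no _) (no _) _ _ = refl

length-filter-∷ : ∀ {a p} {A : Set a} {P : Pred A p} (P? : Decidable P) x xs →
                  length (filter P? (x ∷ xs)) ≡ indicator (P? x) + length (filter P? xs)
length-filter-∷ P? x xs with P? x
... | yes _ = refl
... | no _ = refl

module _ {a} {A : Set a} (_≟_ : DecidableEquality A) where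

  multiplicity : A → List A → ℕ
  multiplicity x [] = 0
  multiplicity x (y ∷ ys) = indicator (y ≟ x) + multiplicity x ys

  multiplicity-++ : ∀ x xs ys →
                    multiplicity x (xs ++ ys) ≡ multiplicity x xs + multiplicity x ys
  multiplicity-++ x [] ys = refl
  multiplicity-++ x (y ∷ xs) ys =
    trans (cong (indicator (y ≟ x) +_) (multiplicity-++ x xs ys))
          (sym (+-assoc (indicator (y ≟ x)) _ _))

  ∈⇒1≤multiplicity : ∀ {x xs} → x ∈ xs → 1 ≤ multiplicity x xs
  ∈⇒1≤multiplicity {x} (here refl) = ≤-trans (1≤indicator (x ≟ x) refl) (m≤m+n _ _)
  ∈⇒1≤multiplicity {x} {y ∷ _} (there x∈) = ≤-trans (∈⇒1≤multiplicity x∈) (m≤n+m _ (indicator (y ≟ x)))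

  1≤multiplicity⇒∈ : ∀ {x} xs → 1 ≤ multiplicity x xs → x ∈ xs
  1≤multiplicity⇒∈ {x} (y ∷ xs) 1≤m with y ≟ x
  ... | yes refl = here refl
  ... | no _ = there (1≤multiplicity⇒∈ xs 1≤m)

  multiplicity≤1⇒∉ : ∀ {x xs} → multiplicity x (x ∷ xs) ≤ 1 → x ∉ xs
  multiplicity≤1⇒∉ {x} {xs} ≤1 x∈ = n≮0 (≤-trans (∈⇒1≤multiplicity x∈) (s≤s⁻¹ 1+mult≤1))
    where
    1+mult≤1 : 1 + multiplicity x xs ≤ 1
    1+mult≤1 = subst (λ n → n + multiplicity x xs ≤ 1) (indicator-yes (x ≟ x) refl) ≤1

module _ {a b} {A : Set a} {B : Set b} (_≟A_ : DecidableEquality A) (_≟B_ : DecidableEquality B)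
         {f : A → B} where

  multiplicity-map-injective : Injective _≡_ _≡_ f → ∀ x xs →
                               multiplicity _≟B_ (f x) (map f xs) ≡ multiplicity _≟A_ x xs
  multiplicity-map-injective inj x [] = refl
  multiplicity-map-injective inj x (y ∷ xs) =
    cong₂ _+_ (indicator-cong (f y ≟B f x) (y ≟A x) inj (cong f))
              (multiplicity-map-injective inj x xs)

  multiplicity-map-∉ : ∀ {y} → (∀ x → f x ≢ y) → ∀ xs → multiplicity _≟B_ y (map f xs) ≡ 0
  multiplicity-map-∉ f≢y [] = refl
  multiplicity-map-∉ {y} f≢y (x ∷ xs) =
    cong₂ _+_ (indicator-no (f x ≟B y) (f≢y x)) (multiplicity-map-∉ f≢y xs)

multiplicity-allFin : ∀ n (i : Fin n) → multiplicity FinP._≟_ i (allFin n) ≡ 1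
multiplicity-allFin (suc n) i
  rewrite sym (ListP.map-tabulate {n = n} (λ j → j) Fin.suc) with i
... | Fin.zero = cong suc (multiplicity-map-∉ FinP._≟_ FinP._≟_ (λ _ ()) (allFin n))
... | Fin.suc j = trans (multiplicity-map-injective FinP._≟_ FinP._≟_ FinP.suc-injective j (allFin n))
                        (multiplicity-allFin n j)

module _ {a} {A : Set a} where

  sum-map-+ : ∀ (f g : A → ℕ) xs →
              sum (map (λ x → f x + g x) xs) ≡ sum (map f xs) + sum (map g xs)
  sum-map-+ f g [] = refl
  sum-map-+ f g (x ∷ xs) = begin
    (f x + g x) + sum (map (λ x → f x + g x) xs)   ≡⟨ cong ((f x + g x) +_) (sum-map-+ f g xs) ⟩
    (f x + g x) + (sum (map f xs) + sum (map g xs)) ≡⟨ +-interchange (f x) (g x) _ _ ⟩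
    (f x + sum (map f xs)) + (g x + sum (map g xs)) ∎
    where open ≡-Reasoning

  ∈⇒≤sum-map : ∀ (f : A → ℕ) {x xs} → x ∈ xs → f x ≤ sum (map f xs)
  ∈⇒≤sum-map f (here refl) = m≤m+n _ _
  ∈⇒≤sum-map f {xs = y ∷ _} (there x∈) = ≤-trans (∈⇒≤sum-map f x∈) (m≤n+m _ (f y))

  sum-map-≤ : ∀ (f : A → ℕ) {k} → (∀ x → f x ≤ k) → ∀ xs → sum (map f xs) ≤ length xs * k
  sum-map-≤ f f≤k [] = z≤n
  sum-map-≤ f f≤k (x ∷ xs) = +-mono-≤ (f≤k x) (sum-map-≤ f f≤k xs)

m+n≡1⇒1≤m⊎1≤n : ∀ {a b} → a + b ≡ 1 → 1 ≤ a ⊎ 1 ≤ b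
m+n≡1⇒1≤m⊎1≤n {zero} a+b≡1 = inj₂ (≤-reflexive (sym a+b≡1))
m+n≡1⇒1≤m⊎1≤n {suc _} _ = inj₁ (s≤s z≤n)

module _ (G : Graph) where
  open Graph G

  IsVertexCover : List V → Set
  IsVertexCover C = ∀ {u v} → Adj u v → u ∈ C ⊎ v ∈ C

  touches? : (e : Edge G) (x : V) → Dec (proj₁ e ≡ x ⊎ proj₂ e ≡ x)
  touches? e x = (proj₁ e ≟V x) ⊎-dec (proj₂ e ≟V x)

  incidence-∷ : ∀ x e M → incidence G x (e ∷ M) ≡ indicator (touches? e x) + incidence G x M
  incidence-∷ x = length-filter-∷ (λ e → touches? e x)

  length≤sum-incidence : ∀ {C} → IsVertexCover C → ∀ M → All (λ e → Adj (proj₁ e) (proj₂ e)) M →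
                         length M ≤ sum (map (λ x → incidence G x M) C)
  length≤sum-incidence cover [] [] = z≤n
  length≤sum-incidence {C} cover (e ∷ M) (adj ∷ adjs) = begin
    1 + length M
      ≤⟨ +-mono-≤ touched (length≤sum-incidence cover M adjs) ⟩
    sum (map touching C) + sum (map (λ x → incidence G x M) C)
      ≡⟨ sum-map-+ touching (λ x → incidence G x M) C ⟨
    sum (map (λ x → touching x + incidence G x M) C)
      ≡⟨ cong sum (ListP.map-cong (λ x → incidence-∷ x e M) C) ⟨
    sum (map (λ x → incidence G x (e ∷ M)) C) ∎
    where
    open ≤-Reasoning
    touching : V → ℕ
    touching x = indicator (touches? e x)
    touched : 1 ≤ sum (map touching C)
    touched with cover adj
    ... | inj₁ u∈C = ≤-trans (1≤indicator (touches? e _) (inj₁ refl)) (∈⇒≤sum-map touching u∈C)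
    ... | inj₂ v∈C = ≤-trans (1≤indicator (touches? e _) (inj₂ refl)) (∈⇒≤sum-map touching v∈C)

  twoMatching-length≤vertexCover*2 : ∀ {C} → IsVertexCover C →
                                     ∀ M → IsTwoMatching G M → length M ≤ length C * 2
  twoMatching-length≤vertexCover*2 {C} cover M (adjs , _ , degree≤2) =
    ≤-trans (length≤sum-incidence cover M adjs) (sum-map-≤ (λ x → incidence G x M) degree≤2 C)

module _ {a p} {A : Set a} {P : Pred A p} where

  length-toList : ∀ {xs} (pxs : All P xs) → length (All.toList pxs) ≡ length xs
  length-toList [] = refl
  length-toList (_ ∷ pxs) = cong suc (length-toList pxs)

  ∈-toList⁺ : (∀ {x} (p q : P x) → p ≡ q) → ∀ {x xs} (pxs : All P xs) →
              x ∈ xs → (px : P x) → (x , px) ∈ All.toList pxs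
  ∈-toList⁺ irr (py ∷ _) (here refl) px = here (cong (_ ,_) (irr px py))
  ∈-toList⁺ irr (_ ∷ pxs) (there x∈) px = there (∈-toList⁺ irr pxs x∈ px)

levels : ℕ → List ℕ
levels zero = [ 0 ]
levels (suc zero) = [ 1 ]
levels (suc (suc m)) = suc (suc m) ∷ levels m

#levels : ℕ → ℕ → ℕ
#levels m n = multiplicity _≟_ n (levels m)

#levels-step : ∀ {m n} → n ≢ 2 + m → #levels (2 + m) n ≡ #levels m n
#levels-step {m} {n} n≢2+m = cong (_+ #levels m n) (indicator-no (2 + m ≟ n) (n≢2+m ∘ sym))

#levels-above : ∀ {m n} → m < n → #levels m n ≡ 0
#levels-above {zero} {suc n} _ = refl
#levels-above {suc zero} {suc zero} (s≤s ())
#levels-above {suc zero} {suc (suc n)} _ = refl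
#levels-above {suc (suc m)} 2+m<n =
  trans (#levels-step (<⇒≢ 2+m<n ∘ sym)) (#levels-above (<-trans (n<1+n m) (<-trans (n<1+n (suc m)) 2+m<n)))

#levels-top : ∀ m → #levels m m ≡ 1
#levels-top zero = refl
#levels-top (suc zero) = refl
#levels-top (suc (suc m)) =
  cong₂ _+_ (indicator-yes (2 + m ≟ 2 + m) refl) (#levels-above (m<n⇒m<1+n (n<1+n m)))

#levels-adjacent : ∀ {m n} → n ≤ m → #levels m n + #levels m (suc n) ≡ 1
#levels-adjacent {zero} {zero} _ = refl
#levels-adjacent {suc zero} {zero} _ = refl
#levels-adjacent {suc zero} {suc zero} _ = refl
#levels-adjacent {suc zero} {suc (suc n)} (s≤s ())
#levels-adjacent {suc (suc m)} n≤2+m with m≤n⇒m<n∨m≡n n≤2+m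
... | inj₂ refl = cong₂ _+_ (#levels-top (2 + m)) (#levels-above (n<1+n (2 + m)))
... | inj₁ (s≤s n≤1+m) with m≤n⇒m<n∨m≡n n≤1+m
...   | inj₂ refl =
  cong₂ _+_ (trans (#levels-step (<⇒≢ (n<1+n (suc m)))) (#levels-above (n<1+n m))) (#levels-top (2 + m))
...   | inj₁ (s≤s n≤m) =
  trans (cong₂ _+_ (#levels-step (<⇒≢ (s≤s (m≤n⇒m≤1+n n≤m)))) (#levels-step (<⇒≢ (s≤s (s≤s n≤m)))))
        (#levels-adjacent n≤m)

#levels-adjacent≤1 : ∀ m n → #levels m n + #levels m (suc n) ≤ 1
#levels-adjacent≤1 m n with n ≤? m
... | yes n≤m = ≤-reflexive (#levels-adjacent n≤m)
... | no n≰m = ≤-trans (≤-reflexive (cong₂ _+_ (#levels-above m<n) (#levels-above (m<n⇒m<1+n m<n)))) z≤n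
  where
  m<n : m < n
  m<n = ≰⇒> n≰m

module Words (q : ℕ) where

  Word : Set
  Word = List (Fin q)

  _≟W_ : DecidableEquality Word
  _≟W_ = ListP.≡-dec FinP._≟_

  mult : Word → List Word → ℕ
  mult = multiplicity _≟W_

  offspring : Word → List Word
  offspring w = map (_∷ w) (allFin q)

  children : List Word → List Word
  children = concatMap offspring

  mult-offspring : ∀ j x w → mult (j ∷ x) (offspring w) ≡ indicator (w ≟W x)
  mult-offspring j x w with w ≟W x
  ... | yes refl = trans (multiplicity-map-injective FinP._≟_ _≟W_ ListP.∷-injectiveˡ j (allFin q))
                         (multiplicity-allFin q j)
  ... | no w≢x = multiplicity-map-∉ FinP._≟_ _≟W_ (λ i e → w≢x (ListP.∷-injectiveʳ e)) (allFin q)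

  mult-children-∷ : ∀ j x L → mult (j ∷ x) (children L) ≡ mult x L
  mult-children-∷ j x [] = refl
  mult-children-∷ j x (w ∷ L) =
    trans (multiplicity-++ _≟W_ (j ∷ x) (offspring w) (children L))
          (cong₂ _+_ (mult-offspring j x w) (mult-children-∷ j x L))

  mult-children-[] : ∀ L → mult [] (children L) ≡ 0
  mult-children-[] [] = refl
  mult-children-[] (w ∷ L) =
    trans (multiplicity-++ _≟W_ [] (offspring w) (children L))
          (cong₂ _+_ (multiplicity-map-∉ FinP._≟_ _≟W_ (λ _ ()) (allFin q)) (mult-children-[] L))

  length-children : ∀ L → length (children L) ≡ q * length L
  length-children [] = sym (*-zeroʳ q)
  length-children (w ∷ L) = begin
    length (offspring w ++ children L)    ≡⟨ ListP.length-++ (offspring w) ⟩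
    length (offspring w) + length (children L)
      ≡⟨ cong₂ _+_ (trans (ListP.length-map (_∷ w) (allFin q)) (ListP.length-tabulate (λ i → i)))
                   (length-children L) ⟩
    q + q * length L                      ≡⟨ *-suc q (length L) ⟨
    q * suc (length L) ∎
    where open ≡-Reasoning

  words : ℕ → List Word
  words zero = [ [] ]
  words (suc k) = children (words k)

  mult-words : ∀ k x → mult x (words k) ≡ indicator (k ≟ length x)
  mult-words zero [] = refl
  mult-words zero (j ∷ x) = refl
  mult-words (suc k) [] = mult-children-[] (words k)
  mult-words (suc k) (j ∷ x) =
    trans (mult-children-∷ j x (words k))
          (trans (mult-words k x)
                 (indicator-cong (k ≟ length x) (suc k ≟ suc (length x)) (cong suc) suc-injective))

  length-words : ∀ k → length (words k) ≡ q ^ k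
  length-words zero = refl
  length-words (suc k) = trans (length-children (words k)) (cong (q *_) (length-words k))

module Tree (d m : ℕ) where
  open Words (d ∸ 1)

  G : Graph
  G = T' d (suc m)

  cover : List Word
  cover = concatMap words (levels m)

  mult-cover : ∀ x → mult x cover ≡ #levels m (length x)
  mult-cover x = go (levels m)
    where
    go : ∀ ks → mult x (concatMap words ks) ≡ multiplicity _≟_ (length x) ks
    go [] = refl
    go (k ∷ ks) = trans (multiplicity-++ _≟W_ x (words k) (concatMap words ks))
                        (cong₂ _+_ (mult-words k x) (go ks))

  length-cover : length cover ≡ sum (map ((d ∸ 1) ^_) (levels m))
  length-cover = go (levels m)
    where
    go : ∀ ks → length (concatMap words ks) ≡ sum (map ((d ∸ 1) ^_) ks)
    go [] = refl
    go (k ∷ ks) = trans (ListP.length-++ (words k)) (cong₂ _+_ (length-words k) (go ks))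

  cover-depth≤ : ∀ {x} → x ∈ cover → length x ≤ m
  cover-depth≤ {x} x∈ = ≮⇒≥ λ m<len →
    n≮0 (≤-trans (∈⇒1≤multiplicity _≟W_ x∈) (≤-reflexive (trans (mult-cover x) (#levels-above m<len))))

  cover-edge : ∀ {s} i → length s ≤ m → s ∈ cover ⊎ (i ∷ s) ∈ cover
  cover-edge {s} i s≤m =
    Sum.map (1≤multiplicity⇒∈ _≟W_ cover) (1≤multiplicity⇒∈ _≟W_ cover)
      (m+n≡1⇒1≤m⊎1≤n (trans (cong₂ _+_ (mult-cover s) (mult-cover (i ∷ s))) (#levels-adjacent s≤m)))

  mult-cover+mult-children≤1 : ∀ x → mult x cover + mult x (children cover) ≤ 1
  mult-cover+mult-children≤1 [] = begin
    mult [] cover + mult [] (children cover) ≡⟨ cong (mult [] cover +_) (mult-children-[] cover) ⟩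
    mult [] cover + 0                        ≡⟨ trans (+-identityʳ _) (mult-cover []) ⟩
    #levels m 0                              ≤⟨ m≤m+n _ _ ⟩
    #levels m 0 + #levels m 1                ≤⟨ #levels-adjacent≤1 m 0 ⟩
    1 ∎
    where open ≤-Reasoning
  mult-cover+mult-children≤1 (j ∷ x) = begin
    mult (j ∷ x) cover + mult (j ∷ x) (children cover)
      ≡⟨ cong₂ _+_ (mult-cover (j ∷ x)) (trans (mult-children-∷ j x cover) (mult-cover x)) ⟩
    #levels m (suc (length x)) + #levels m (length x) ≡⟨ +-comm (#levels m (suc (length x))) _ ⟩
    #levels m (length x) + #levels m (suc (length x)) ≤⟨ #levels-adjacent≤1 m (length x) ⟩
    1 ∎
    where open ≤-Reasoning

  cover-unique : ∀ x → mult x cover ≤ 1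
  cover-unique x = ≤-trans (m≤m+n _ _) (mult-cover+mult-children≤1 x)

  cover-depths : All (λ w → length w ≤ m) cover
  cover-depths = All.tabulate cover-depth≤

  coverVertices : List (TVertex d (suc m))
  coverVertices = All.toList (All.map m≤n⇒m≤1+n cover-depths)

  ∈-coverVertices : ∀ {w} → w ∈ cover → (p : length w ≤ suc m) → (w , p) ∈ coverVertices
  ∈-coverVertices = ∈-toList⁺ ≤-irrelevant (All.map m≤n⇒m≤1+n cover-depths)

  coverVertices-isVertexCover : IsVertexCover G coverVertices
  coverVertices-isVertexCover {s , ps} {t , pt} (inj₁ (i , refl)) =
    Sum.map (λ s∈ → ∈-coverVertices s∈ ps) (λ t∈ → ∈-coverVertices t∈ pt) (cover-edge i (s≤s⁻¹ pt))
  coverVertices-isVertexCover {s , ps} {t , pt} (inj₂ (i , refl)) =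
    Sum.swap (Sum.map (λ t∈ → ∈-coverVertices t∈ pt) (λ s∈ → ∈-coverVertices s∈ ps)
                      (cover-edge i (s≤s⁻¹ ps)))

  twoMatching-length≤cover*2 : ∀ M → IsTwoMatching G M → length M ≤ length cover * 2
  twoMatching-length≤cover*2 M isTwoMatching =
    subst (λ n → length M ≤ n * 2) (length-toList (All.map m≤n⇒m≤1+n cover-depths))
          (twoMatching-length≤vertexCover*2 G coverVertices-isVertexCover M isTwoMatching)

  childEdge : ∀ w → length w ≤ m → Fin (d ∸ 1) → Edge G
  childEdge w w≤m i = (w , m≤n⇒m≤1+n w≤m) , (i ∷ w , s≤s w≤m)

  childEdge-injective : ∀ {w w′ i j} {p : length w ≤ m} {p′ : length w′ ≤ m} →
                        SameEdge G (childEdge w p i) (childEdge w′ p′ j) → w ≡ w′ × i ≡ j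
  childEdge-injective (inj₁ (_ , e)) with ListP.∷-injective (cong proj₁ e)
  ... | i≡j , w≡w′ = w≡w′ , i≡j
  childEdge-injective {w} (inj₂ (e₁ , e₂)) =
    contradiction (trans (cong (length ∘ proj₁) e₁) (cong suc (sym (cong (length ∘ proj₁) e₂))))
                  (<⇒≢ (m<n⇒m<1+n (n<1+n (length w))))

  childEdge-endpoint : ∀ w (p : length w ≤ m) i {v} →
                       proj₁ (childEdge w p i) ≡ v ⊎ proj₂ (childEdge w p i) ≡ v → proj₁ v ∈ w ∷ offspring w
  childEdge-endpoint w p i (inj₁ refl) = here refl
  childEdge-endpoint w p i (inj₂ refl) = there (∈-map⁺ (_∷ w) (∈-allFin i))

  module Stars (i j : Fin (d ∸ 1)) (i≢j : i ≢ j) where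

    stars : ∀ {L} → All (λ w → length w ≤ m) L → List (Edge G)
    stars [] = []
    stars {w ∷ _} (p ∷ ps) = childEdge w p i ∷ childEdge w p j ∷ stars ps

    length-stars : ∀ {L} (ps : All (λ w → length w ≤ m) L) → length (stars ps) ≡ length L * 2
    length-stars [] = refl
    length-stars (_ ∷ ps) = cong (2 +_) (length-stars ps)

    stars-adjacent : ∀ {L} (ps : All (λ w → length w ≤ m) L) →
                     All (λ e → TAdj d (suc m) (proj₁ e) (proj₂ e)) (stars ps)
    stars-adjacent [] = []
    stars-adjacent (_ ∷ ps) = inj₁ (i , refl) ∷ inj₁ (j , refl) ∷ stars-adjacent ps

    childEdge-fresh : ∀ {w L} (p : length w ≤ m) k (ps : All (λ w → length w ≤ m) L) → w ∉ L →
                      All (λ f → ¬ SameEdge G (childEdge w p k) f) (stars ps)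
    childEdge-fresh p k [] _ = []
    childEdge-fresh {w} {w′ ∷ _} p k (p′ ∷ ps) w∉ = new ∷ new ∷ childEdge-fresh p k ps (w∉ ∘ there)
      where
      new : ∀ {l} → ¬ SameEdge G (childEdge w p k) (childEdge w′ p′ l)
      new same = w∉ (here (proj₁ (childEdge-injective same)))

    stars-distinct : ∀ {L} (ps : All (λ w → length w ≤ m) L) → (∀ x → mult x L ≤ 1) →
                     AllPairs (λ e f → ¬ SameEdge G e f) (stars ps)
    stars-distinct [] _ = []
    stars-distinct {w ∷ L} (p ∷ ps) unique =
      ((λ same → i≢j (proj₂ (childEdge-injective same))) ∷ childEdge-fresh p i ps w∉L)
        ∷ childEdge-fresh p j ps w∉L
        ∷ stars-distinct ps (λ x → ≤-trans (m≤n+m _ _) (unique x))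
      where
      w∉L : w ∉ L
      w∉L = multiplicity≤1⇒∉ _≟W_ (unique w)

    incidence-stars : ∀ {L} (ps : All (λ w → length w ≤ m) L) x px →
                      incidence G (x , px) (stars ps) ≤ 2 * (mult x L + mult x (children L))
    incidence-stars [] x px = z≤n
    incidence-stars {w ∷ L} (p ∷ ps) x px = begin
      incidence G v (childEdge w p i ∷ childEdge w p j ∷ stars ps)
        ≡⟨ trans (incidence-∷ G v (childEdge w p i) _)
                 (cong (touching i +_) (incidence-∷ G v (childEdge w p j) _)) ⟩
      touching i + (touching j + incidence G v (stars ps))
        ≤⟨ +-mono-≤ (touching≤ i) (+-mono-≤ (touching≤ j) (incidence-stars ps x px)) ⟩
      mult x (w ∷ offspring w) + (mult x (w ∷ offspring w) + 2 * (mult x L + mult x (children L)))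
        ≡⟨ rearrange (indicator (w ≟W x)) (mult x (offspring w)) (mult x L) (mult x (children L)) ⟩
      2 * (mult x (w ∷ L) + (mult x (offspring w) + mult x (children L)))
        ≡⟨ cong (λ n → 2 * (mult x (w ∷ L) + n)) (multiplicity-++ _≟W_ x (offspring w) (children L)) ⟨
      2 * (mult x (w ∷ L) + mult x (children (w ∷ L))) ∎
      where
      open ≤-Reasoning
      v : TVertex d (suc m)
      v = x , px
      touching : Fin (d ∸ 1) → ℕ
      touching k = indicator (touches? G (childEdge w p k) v)
      touching≤ : ∀ k → touching k ≤ mult x (w ∷ offspring w)
      touching≤ k =
        indicator≤ (touches? G (childEdge w p k) v) (∈⇒1≤multiplicity _≟W_ ∘ childEdge-endpoint w p k)
      rearrange : ∀ a b A B → (a + b) + ((a + b) + 2 * (A + B)) ≡ 2 * ((a + A) + (b + B))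
      rearrange = solve-∀

    starMatching : ∃[ M ] (IsTwoMatching G M × length M ≡ length cover * 2)
    starMatching =
      stars cover-depths ,
      (stars-adjacent cover-depths , stars-distinct cover-depths cover-unique , degree≤2) ,
      length-stars cover-depths
      where
      degree≤2 : ∀ v → incidence G v (stars cover-depths) ≤ 2
      degree≤2 (x , px) =
        ≤-trans (incidence-stars cover-depths x px) (*-monoʳ-≤ 2 (mult-cover+mult-children≤1 x))

geometric-step : ∀ q {Q s t} k → Q + 1 ≡ q ^ 2 → s * Q + t ≡ q ^ k → (q ^ k + s) * Q + t ≡ q ^ (2 + k)
geometric-step q {Q} {s} {t} k Q+1≡q² sQ+t≡qᵏ = begin
  (q ^ k + s) * Q + t       ≡⟨ regroup (q ^ k) s Q t ⟩
  q ^ k * Q + (s * Q + t)   ≡⟨ cong (q ^ k * Q +_) sQ+t≡qᵏ ⟩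
  q ^ k * Q + q ^ k         ≡⟨ factor (q ^ k) Q ⟩
  (Q + 1) * q ^ k           ≡⟨ cong (_* q ^ k) Q+1≡q² ⟩
  q ^ 2 * q ^ k             ≡⟨ ^-distribˡ-+-* q 2 k ⟨
  q ^ (2 + k) ∎
  where
  open ≡-Reasoning
  regroup : ∀ A s Q t → (A + s) * Q + t ≡ A * Q + (s * Q + t)
  regroup = solve-∀
  factor : ∀ A Q → A * Q + A ≡ (Q + 1) * A
  factor = solve-∀

-- The series q^m + q^(m−2) + ⋯ ends at q⁰ or at q¹ according to the parity of m.
levels-sum-closedForm : ∀ {q Q} → Q + 1 ≡ q ^ 2 → ∀ m →
  (suc m % 2 ≡ 0 → sum (map (q ^_) (levels m)) * Q + q ≡ q ^ (2 + m)) ×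
  (suc m % 2 ≡ 1 → sum (map (q ^_) (levels m)) * Q + 1 ≡ q ^ (2 + m))
levels-sum-closedForm {q} Q+1≡q² zero = (λ ()) , λ _ → geometric-step q {s = 0} 0 Q+1≡q² refl
levels-sum-closedForm {q} Q+1≡q² (suc zero) =
  (λ _ → geometric-step q {s = 0} 1 Q+1≡q² (sym (*-identityʳ q))) , λ ()
levels-sum-closedForm {q} Q+1≡q² (suc (suc m)) =
  (λ even → geometric-step q (2 + m) Q+1≡q²
              (proj₁ (levels-sum-closedForm Q+1≡q² m) (trans (sym parity) even))) ,
  (λ odd → geometric-step q (2 + m) Q+1≡q²
             (proj₂ (levels-sum-closedForm Q+1≡q² m) (trans (sym parity) odd)))
  where
  parity : suc (suc (suc m)) % 2 ≡ suc m % 2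
  parity = trans (cong (_% 2) (+-comm 2 (suc m))) ([m+n]%n≡m%n (suc m) 2)

double-difference : ∀ {s Q t A} → s * Q + t ≡ A → (s * 2) * Q ≡ 2 * (A ∸ t)
double-difference {s} {Q} {t} {A} sQ+t≡A = begin
  (s * 2) * Q        ≡⟨ swap s Q ⟩
  2 * (s * Q)        ≡⟨ cong (2 *_) (m+n∸n≡m (s * Q) t) ⟨
  2 * (s * Q + t ∸ t) ≡⟨ cong (λ n → 2 * (n ∸ t)) sQ+t≡A ⟩
  2 * (A ∸ t) ∎
  where
  open ≡-Reasoning
  swap : ∀ s Q → (s * 2) * Q ≡ 2 * (s * Q)
  swap = solve-∀

lemma5p4 : ∀ (d h : ℕ) → 3 ≤ d → 2 ≤ h →
    ∃[ N ] (Nu2≡ (T' d h) N ×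
      (h % 2 ≡ 0 → N * ((d ∸ 1) ^ 2 ∸ 1) ≡ 2 * ((d ∸ 1) ^ (h + 1) ∸ (d ∸ 1))) ×
      (h % 2 ≡ 1 → N * ((d ∸ 1) ^ 2 ∸ 1) ≡ 2 * ((d ∸ 1) ^ (h + 1) ∸ 1)))
lemma5p4 (suc (suc (suc r))) (suc m) (s≤s (s≤s (s≤s _))) (s≤s _) =
  length cover * 2 , (starMatching , twoMatching-length≤cover*2) ,
  scaled ∘ proj₁ (levels-sum-closedForm Q+1≡q² m) , scaled ∘ proj₂ (levels-sum-closedForm Q+1≡q² m)
  where
  open Tree (3 + r) m
  open Stars Fin.zero (Fin.suc Fin.zero) (λ ())
  q Q : ℕ
  q = 2 + r
  Q = q ^ 2 ∸ 1
  Q+1≡q² : Q + 1 ≡ q ^ 2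
  Q+1≡q² = m∸n+n≡m (s≤s z≤n)
  scaled : ∀ {t} → sum (map (q ^_) (levels m)) * Q + t ≡ q ^ (2 + m) →
           (length cover * 2) * Q ≡ 2 * (q ^ (suc m + 1) ∸ t)
  scaled {t} e = double-difference {length cover} {Q} {t}
    (trans (cong (λ s → s * Q + t) length-cover) (trans e (cong (λ k → q ^ suc k) (+-comm 1 m))))
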